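{- Let $\phi$ be a $\mathbf{Gr}(\mathbf{K}_\mathcal{R})$-formula in negation normal form. Every sequence of rule applications of the optimised algorithm starting from the constraint system $\{x_0\models\phi\}$ is finite.
   Context: Formulae in NNF: $p$, $\neg p$, $\psi_1\wedge\psi_2$, $\psi_1\vee\psi_2$, $\langle R\rangle_{\ge n}\psi$, $\langle R\rangle_{\le n}\psi$ (at least / at most $n$ $R$-successors satisfy $\psi$). $\sim\psi$ is the NNF of $\neg\psi$ (De Morgan, $\neg\langle R\rangle_{\ge 0}\psi\equiv p\wedge\neg p$, $\neg\langle R\rangle_{\ge n}\psi\equiv\langle R\rangle_{\le n-1}\psi$ for $n\ge1$, $\neg\langle R\rangle_{\le n}\psi\equiv\langle R\rangle_{\ge n+1}\psi$). A constraint system (c.s.) is a finite set of expressions $x\models\psi$ and $Rxy$ over variables; $\sharp R^S(x,\psi)=|\{y:\{Rxy,y\models\psi\}\subseteq S\}|$. Rules of the optimised algorithm: ($\wedge$) if $x\models\psi_1\wedge\psi_2\in S$ and not both $x\models\psi_1,x\models\psi_2\in S$, add both; ($\vee$) if $x\models\psi_1\vee\psi_2\in S$ and neither disjunct constraint is in $S$, add $x\models\chi$ for a chosen $\chi\in\{\psi_1,\psi_2\}$; ($\ge$) if $x\models\langle R\rangle_{\ge n}\psi\in S$, $\sharp R^S(x,\psi)<n$, and neither the $\wedge$- nor $\vee$-rule applies to a constraint for $x$, add $Rxy$, $y\models\psi$, $y\models\chi_1,\dots,y\models\chi_k$ for a fresh variable $y$, where $\{\psi_1,\dots,\psi_k\}=\{\psi':x\models\langle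 R\rangle_{\bowtie m}\psi'\in S,\ \bowtie\in\{\le,\ge\}\}$ and each $\chi_i\in\{\psi_i,\sim\psi_i\}$ is chosen nondeterministically. -}

module Defs where

open import Data.Nat using (ℕ; zero; suc; _<_)
open import Data.Bool using (Bool; true; false)
open import Data.List using (List; []; _∷_; _++_; map; length)
open import Data.List.Membership.Propositional using (_∈_; _∉_)
open import Data.List.Relation.Unary.All using (All)
open import Data.List.Relation.Unary.Unique.Propositional using (Unique)
open import Data.Product using (Σ; _×_; _,_; proj₁)
open import Data.Sum using (_⊎_)
open import Relation.Nullary using (¬_)
open import Relation.Binary.PropositionalEquality using (_≡_)

Prop : Set
Prop = ℕ

Rel : Set
Rel = ℕ

Var : Set
Var = ℕ

data Fml : Set where
  atom  : Prop → Fml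
  natom : Prop → Fml
  _∧_   : Fml → Fml → Fml
  _∨_   : Fml → Fml → Fml
  ⟨_⟩≥_∙_ : Rel → ℕ → Fml → Fml
  ⟨_⟩≤_∙_ : Rel → ℕ → Fml → Fml

-- ∼ψ : the NNF of ¬ψ.  ¬⟨R⟩_{≥0}ψ is rendered as p ∧ ¬p with p = 0.
∼_ : Fml → Fml
∼ atom p = natom p
∼ natom p = atom p
∼ (ψ₁ ∧ ψ₂) = (∼ ψ₁) ∨ (∼ ψ₂)
∼ (ψ₁ ∨ ψ₂) = (∼ ψ₁) ∧ (∼ ψ₂)
∼ (⟨ R ⟩≥ zero ∙ ψ) = atom 0 ∧ natom 0
∼ (⟨ R ⟩≥ suc n ∙ ψ) = ⟨ R ⟩≤ n ∙ ψ
∼ (⟨ R ⟩≤ n ∙ ψ) = ⟨ R ⟩≥ suc n ∙ ψ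

data Constraint : Set where
  _⊨_  : Var → Fml → Constraint
  edge : Rel → Var → Var → Constraint

-- A constraint system is a finite set of constraints, represented as a list
-- (only membership matters; duplicates are irrelevant).
CS : Set
CS = List Constraint

OccursIn : Var → Constraint → Set
OccursIn y (x ⊨ ψ) = y ≡ x
OccursIn y (edge R x z) = (y ≡ x) ⊎ (y ≡ z)

Fresh : Var → CS → Set
Fresh y S = All (λ c → ¬ OccursIn y c) S

CountAtLeast : CS → Rel → Var → Fml → ℕ → Set
CountAtLeast S R x ψ n =
  Σ (List Var) λ ys → Unique ys × length ys ≡ n ×
    All (λ y → (edge R x y ∈ S) × ((y ⊨ ψ) ∈ S)) ys

CountBelow : CS → Rel → Var → Fml → ℕ → Set
CountBelow S R x ψ n = ¬ CountAtLeast S R x ψ n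

∧Applicable : CS → Var → Fml → Fml → Set
∧Applicable S x ψ₁ ψ₂ =
  ((x ⊨ (ψ₁ ∧ ψ₂)) ∈ S) × ¬ (((x ⊨ ψ₁) ∈ S) × ((x ⊨ ψ₂) ∈ S))

∨Applicable : CS → Var → Fml → Fml → Set
∨Applicable S x ψ₁ ψ₂ =
  ((x ⊨ (ψ₁ ∨ ψ₂)) ∈ S) × ((x ⊨ ψ₁) ∉ S) × ((x ⊨ ψ₂) ∉ S)

InModalSet : CS → Rel → Var → Fml → Set
InModalSet S R x ψ' =
  Σ ℕ λ m → ((x ⊨ (⟨ R ⟩≥ m ∙ ψ')) ∈ S) ⊎ ((x ⊨ (⟨ R ⟩≤ m ∙ ψ')) ∈ S)

choose : Fml × Bool → Fml
choose (ψ , true) = ψ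
choose (ψ , false) = ∼ ψ

data _⟶_ : CS → CS → Set where
  ∧-rule : ∀ {S x ψ₁ ψ₂} → ∧Applicable S x ψ₁ ψ₂ →
           S ⟶ ((x ⊨ ψ₁) ∷ (x ⊨ ψ₂) ∷ S)
  ∨-rule₁ : ∀ {S x ψ₁ ψ₂} → ∨Applicable S x ψ₁ ψ₂ →
           S ⟶ ((x ⊨ ψ₁) ∷ S)
  ∨-rule₂ : ∀ {S x ψ₁ ψ₂} → ∨Applicable S x ψ₁ ψ₂ →
           S ⟶ ((x ⊨ ψ₂) ∷ S)
  ≥-rule : ∀ {S x R n ψ y} (cs : List (Fml × Bool)) →
           ((x ⊨ (⟨ R ⟩≥ n ∙ ψ)) ∈ S) →
           CountBelow S R x ψ n →
           (∀ ψ₁ ψ₂ → ¬ ∧Applicable S x ψ₁ ψ₂) →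
           (∀ ψ₁ ψ₂ → ¬ ∨Applicable S x ψ₁ ψ₂) →
           Fresh y S →
           -- cs lists each element ψ_i of the modal set exactly once,
           -- paired with the choice χ_i ∈ {ψ_i, ∼ψ_i}
           Unique (map proj₁ cs) →
           (∀ ψ' → InModalSet S R x ψ' → ψ' ∈ map proj₁ cs) →
           All (λ ψ' → InModalSet S R x ψ') (map proj₁ cs) →
           S ⟶ (edge R x y ∷ (y ⊨ ψ) ∷ (map (λ c → y ⊨ choose c) cs ++ S))

InfiniteRun : CS → Set
InfiniteRun S = Σ (ℕ → CS) λ f → (f 0 ≡ S) × (∀ i → f i ⟶ f (suc i))

{-# OPTIONS --safe #-}
module Submission where

-- Every formula the rules introduce lies in a finite closure of φ: the subformulas of φ
-- and the subformulas of their negations.  Give each variable u the potential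
--   missing u + deficit u · weight (depth u),
-- where missing u counts the closure formulas not yet asserted of u, deficit u sums
-- n ∸ ♯R(u, ψ) over the formulas ⟨R⟩≥n ψ of the closure, and depth u is the largest
-- modal depth of a formula asserted of u.  The ∧- and ∨-rules lower missing at one
-- variable and raise no other potential.  The ≥-rule fires only while ♯R(x, ψ) < n and
-- adds a fresh R-successor y of x satisfying ψ, so it lowers the deficit of x by one;
-- as y has smaller depth than x, the whole potential of y is below weight (depth x),
-- and the total potential still drops.  A strictly decreasing sequence of natural
-- numbers is finite.

open import Defs
open import Function using (_∘_)
open import Data.Empty using (⊥-elim)
open import Data.Nat using (ℕ; zero; suc; _+_; _*_; _∸_; _≤_; _<_; _≤′_; _⊔_; z≤n; s≤s)
import Data.Nat as ℕ
open import Data.Nat.Properties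
open import Data.Nat.Induction using (<-wellFounded)
open import Data.Bool using (true; false)
open import Algebra.Properties.CommutativeSemigroup +-commutativeSemigroup
  renaming (interchange to +-interchange)
open import Data.List using (List; []; _∷_; _++_; map; concatMap; length; downFrom; filter; take)
open import Data.List.Properties using (map-∘; length-take)
open import Data.List.Membership.Propositional using (_∈_; _∉_; find; lose)
open import Data.List.Membership.Propositional.Properties
  using (∈-++⁺ˡ; ∈-++⁺ʳ; ∈-++⁻; ∈-map⁺; ∈-map⁻; ∈-concatMap⁺; ∈-downFrom⁺)
open import Data.List.Relation.Unary.Any using (Any; here; there; any?; satisfied)
import Data.List.Relation.Unary.Any as Any
import Data.List.Relation.Unary.Any.Properties as Any
open import Data.List.Relation.Unary.All using (All; []; _∷_)
import Data.List.Relation.Unary.All as All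
import Data.List.Relation.Unary.All.Properties as All
open import Data.List.Relation.Unary.Unique.Propositional using (Unique)
import Data.List.Relation.Unary.Unique.Propositional.Properties as Unique
open import Data.Product using (∃-syntax; _×_; _,_; proj₁; proj₂)
import Data.Product
open import Data.Sum using (_⊎_; inj₁; inj₂; [_,_]′)
open import Induction.InfiniteDescent using (InfiniteDescendingSequence; descent∧wf⇒empty)
open import Relation.Binary.Definitions using (DecidableEquality)
open import Relation.Binary.PropositionalEquality
  using (_≡_; _≢_; refl; sym; trans; cong; subst; subst₂)
open import Relation.Nullary using (¬_; Dec; yes; no)
open import Relation.Nullary.Decidable using (map′; ¬?; _×-dec_; _⊎-dec_)
open import Relation.Unary using (Decidable)

when : {P : Set} → Dec P → ℕ → ℕ
when (yes _) c = c
when (no _) _ = 0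

𝟙 : {P : Set} → Dec P → ℕ
𝟙 p = when p 1

𝟙-mono : {P Q : Set} → (P → Q) → (p : Dec P) (q : Dec Q) → 𝟙 p ≤ 𝟙 q
𝟙-mono P⇒Q (yes P) (no ¬Q) = ⊥-elim (¬Q (P⇒Q P))
𝟙-mono _ (yes _) (yes _) = ≤-refl
𝟙-mono _ (no _) _ = z≤n

𝟙-< : {P Q : Set} → ¬ P → Q → (p : Dec P) (q : Dec Q) → 𝟙 p < 𝟙 q
𝟙-< ¬P _ (yes P) _ = ⊥-elim (¬P P)
𝟙-< _ Q (no _) (no ¬Q) = ⊥-elim (¬Q Q)
𝟙-< _ _ (no _) (yes _) = ≤-refl

𝟙≤1 : {P : Set} (p : Dec P) → 𝟙 p ≤ 1
𝟙≤1 (yes _) = ≤-refl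
𝟙≤1 (no _) = z≤n

module _ {A : Set} where

  ∑ : (A → ℕ) → List A → ℕ
  ∑ f [] = 0
  ∑ f (a ∷ as) = f a + ∑ f as

  ∑-mono-≤ : ∀ {f g : A → ℕ} as → (∀ a → f a ≤ g a) → ∑ f as ≤ ∑ g as
  ∑-mono-≤ [] _ = z≤n
  ∑-mono-≤ (a ∷ as) f≤g = +-mono-≤ (f≤g a) (∑-mono-≤ as f≤g)

  ∑-mono-< : ∀ {f g : A → ℕ} {a as} → a ∈ as → (∀ a → f a ≤ g a) → f a < g a →
             ∑ f as < ∑ g as
  ∑-mono-< {as = _ ∷ as} (here refl) f≤g fa<ga = +-mono-<-≤ fa<ga (∑-mono-≤ as f≤g)
  ∑-mono-< {as = b ∷ _} (there a∈as) f≤g fa<ga =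
    +-mono-≤-< (f≤g b) (∑-mono-< a∈as f≤g fa<ga)

  ∑-+ : ∀ (f g : A → ℕ) as → ∑ (λ a → f a + g a) as ≡ ∑ f as + ∑ g as
  ∑-+ f g [] = refl
  ∑-+ f g (a ∷ as) =
    trans (cong (f a + g a +_) (∑-+ f g as)) (+-interchange (f a) (g a) (∑ f as) (∑ g as))

  ∑-++ : ∀ (f : A → ℕ) as bs → ∑ f (as ++ bs) ≡ ∑ f as + ∑ f bs
  ∑-++ f [] bs = refl
  ∑-++ f (a ∷ as) bs =
    trans (cong (f a +_) (∑-++ f as bs)) (sym (+-assoc (f a) (∑ f as) (∑ f bs)))

  ∑-∈-≤ : ∀ (f : A → ℕ) {a as} → a ∈ as → f a ≤ ∑ f as
  ∑-∈-≤ f {as = _ ∷ as} (here refl) = m≤m+n _ (∑ f as)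
  ∑-∈-≤ f {as = b ∷ _} (there a∈as) = ≤-trans (∑-∈-≤ f a∈as) (m≤n+m _ (f b))

  ∑-≤-length : ∀ {f : A → ℕ} as → (∀ a → f a ≤ 1) → ∑ f as ≤ length as
  ∑-≤-length [] _ = z≤n
  ∑-≤-length (a ∷ as) f≤1 = +-mono-≤ (f≤1 a) (∑-≤-length as f≤1)

∑< : ℕ → (ℕ → ℕ) → ℕ
∑< B f = ∑ f (downFrom B)

∑<-extend : ∀ {B B′} (f : ℕ → ℕ) → B ≤ B′ → (∀ u → B ≤ u → f u ≡ 0) →
            ∑< B′ f ≡ ∑< B f
∑<-extend {B} f B≤B′ vanish = go (≤⇒≤′ B≤B′)
  where
  go : ∀ {B′} → B ≤′ B′ → ∑< B′ f ≡ ∑< B f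
  go ℕ.≤′-refl = refl
  go (ℕ.≤′-step {n = B′} B≤′B′) =
    trans (cong (_+ ∑< B′ f) (vanish B′ (≤′⇒≤ B≤′B′))) (go B≤′B′)

∑<-grow : ∀ {B B′} (f : ℕ → ℕ) → B ≤ B′ → ∑< B f ≤ ∑< B′ f
∑<-grow {B} f B≤B′ = go (≤⇒≤′ B≤B′)
  where
  go : ∀ {B′} → B ≤′ B′ → ∑< B f ≤ ∑< B′ f
  go ℕ.≤′-refl = ≤-refl
  go (ℕ.≤′-step {n = B′} B≤′B′) = ≤-trans (go B≤′B′) (m≤n+m _ (f B′))

∑<-point-below : ∀ {x B} c → B ≤ x → ∑< B (λ u → when (x ℕ.≟ u) c) ≡ 0
∑<-point-below {B = zero} _ _ = refl
∑<-point-below {x} {suc B} c B<x with x ℕ.≟ B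
... | yes refl = ⊥-elim (<-irrefl refl B<x)
... | no _ = ∑<-point-below c (<⇒≤ B<x)

∑<-point : ∀ {x B} c → x < B → ∑< B (λ u → when (x ℕ.≟ u) c) ≡ c
∑<-point {x} {suc B} c x<1+B with x ℕ.≟ B
... | yes refl = trans (cong (c +_) (∑<-point-below {x} c ≤-refl)) (+-identityʳ c)
... | no x≢B = ∑<-point c (≤∧≢⇒< (≤-pred x<1+B) x≢B)

∑<-transfer : ∀ {B x y k} (f g : ℕ → ℕ) → x < B → y < B →
              (∀ u → f u + when (x ℕ.≟ u) (suc k) ≤ g u + when (y ℕ.≟ u) k) →
              ∑< B f < ∑< B g
∑<-transfer {B} {x} {y} {k} f g x<B y<B f≤g = +-cancelʳ-< k (∑< B f) (∑< B g) (begin-strict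
  ∑< B f + k                                    <⟨ +-monoʳ-< (∑< B f) (n<1+n k) ⟩
  ∑< B f + suc k                                ≡⟨ cong (∑< B f +_) (∑<-point (suc k) x<B) ⟨
  ∑< B f + ∑< B (λ u → when (x ℕ.≟ u) (suc k))  ≡⟨ ∑-+ f _ (downFrom B) ⟨
  ∑< B (λ u → f u + when (x ℕ.≟ u) (suc k))     ≤⟨ ∑-mono-≤ (downFrom B) f≤g ⟩
  ∑< B (λ u → g u + when (y ℕ.≟ u) k)           ≡⟨ ∑-+ g _ (downFrom B) ⟩
  ∑< B g + ∑< B (λ u → when (y ℕ.≟ u) k)        ≡⟨ cong (∑< B g +_) (∑<-point k y<B) ⟩
  ∑< B g + k                                    ∎)
  where open ≤-Reasoning

module _ {P : ℕ → Set} (P? : Decidable P) where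

  length-filter-downFrom : ∀ B → length (filter P? (downFrom B)) ≡ ∑< B (λ v → 𝟙 (P? v))
  length-filter-downFrom zero = refl
  length-filter-downFrom (suc B) with P? B
  ... | yes _ = cong suc (length-filter-downFrom B)
  ... | no _ = length-filter-downFrom B

  ∑<-𝟙-witnesses : ∀ {n} B → n ≤ ∑< B (λ v → 𝟙 (P? v)) →
                   ∃[ vs ] Unique vs × length vs ≡ n × All P vs
  ∑<-𝟙-witnesses {n} B n≤∑ =
    take n vs ,
    Unique.take⁺ n (Unique.filter⁺ P? (Unique.downFrom⁺ B)) ,
    trans (length-take n vs) (m≤n⇒m⊓n≡m (subst (n ≤_) (sym (length-filter-downFrom B)) n≤∑)) ,
    All.take⁺ n (All.all-filter P? (downFrom B))
    where
    vs : List ℕ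
    vs = filter P? (downFrom B)

no-infinite-descent : (g : ℕ → ℕ) → ¬ InfiniteDescendingSequence _<_ g
no-infinite-descent g desc = descent∧wf⇒empty descent <-wellFounded (g 0) (0 , refl)
  where
  descent : ∀ {n} → ∃[ i ] g i ≡ n → ∃[ m ] m < n × ∃[ i ] g i ≡ m
  descent (i , refl) = g (suc i) , desc i , suc i , refl

md : Fml → ℕ
md (atom _) = 0
md (natom _) = 0
md (a ∧ b) = md a ⊔ md b
md (a ∨ b) = md a ⊔ md b
md (⟨ _ ⟩≥ _ ∙ a) = suc (md a)
md (⟨ _ ⟩≤ _ ∙ a) = suc (md a)

md-∼ : ∀ ψ → md (∼ ψ) ≤ md ψ
md-∼ (atom _) = z≤n
md-∼ (natom _) = z≤n
md-∼ (a ∧ b) = ⊔-mono-≤ (md-∼ a) (md-∼ b)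
md-∼ (a ∨ b) = ⊔-mono-≤ (md-∼ a) (md-∼ b)
md-∼ (⟨ _ ⟩≥ zero ∙ _) = z≤n
md-∼ (⟨ _ ⟩≥ suc _ ∙ _) = ≤-refl
md-∼ (⟨ _ ⟩≤ _ ∙ _) = ≤-refl

infix 4 _⊑_

data _⊑_ : Fml → Fml → Set where
  ⊑-refl : ∀ {ψ} → ψ ⊑ ψ
  ⊑-∧ˡ : ∀ {ψ a b} → ψ ⊑ a → ψ ⊑ a ∧ b
  ⊑-∧ʳ : ∀ {ψ a b} → ψ ⊑ b → ψ ⊑ a ∧ b
  ⊑-∨ˡ : ∀ {ψ a b} → ψ ⊑ a → ψ ⊑ a ∨ b
  ⊑-∨ʳ : ∀ {ψ a b} → ψ ⊑ b → ψ ⊑ a ∨ b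
  ⊑-≥ : ∀ {ψ R n a} → ψ ⊑ a → ψ ⊑ ⟨ R ⟩≥ n ∙ a
  ⊑-≤ : ∀ {ψ R n a} → ψ ⊑ a → ψ ⊑ ⟨ R ⟩≤ n ∙ a

⊑-trans : ∀ {ψ χ θ} → ψ ⊑ χ → χ ⊑ θ → ψ ⊑ θ
⊑-trans ψ⊑χ ⊑-refl = ψ⊑χ
⊑-trans ψ⊑χ (⊑-∧ˡ χ⊑θ) = ⊑-∧ˡ (⊑-trans ψ⊑χ χ⊑θ)
⊑-trans ψ⊑χ (⊑-∧ʳ χ⊑θ) = ⊑-∧ʳ (⊑-trans ψ⊑χ χ⊑θ)
⊑-trans ψ⊑χ (⊑-∨ˡ χ⊑θ) = ⊑-∨ˡ (⊑-trans ψ⊑χ χ⊑θ)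
⊑-trans ψ⊑χ (⊑-∨ʳ χ⊑θ) = ⊑-∨ʳ (⊑-trans ψ⊑χ χ⊑θ)
⊑-trans ψ⊑χ (⊑-≥ χ⊑θ) = ⊑-≥ (⊑-trans ψ⊑χ χ⊑θ)
⊑-trans ψ⊑χ (⊑-≤ χ⊑θ) = ⊑-≤ (⊑-trans ψ⊑χ χ⊑θ)

subformulas : Fml → List Fml
properSubformulas : Fml → List Fml

subformulas ψ = ψ ∷ properSubformulas ψ

properSubformulas (atom _) = []
properSubformulas (natom _) = []
properSubformulas (a ∧ b) = subformulas a ++ subformulas b
properSubformulas (a ∨ b) = subformulas a ++ subformulas b
properSubformulas (⟨ _ ⟩≥ _ ∙ a) = subformulas a
properSubformulas (⟨ _ ⟩≤ _ ∙ a) = subformulas a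

⊑⇒∈subformulas : ∀ {ψ χ} → ψ ⊑ χ → ψ ∈ subformulas χ
⊑⇒∈subformulas ⊑-refl = here refl
⊑⇒∈subformulas (⊑-∧ˡ ψ⊑a) = there (∈-++⁺ˡ (⊑⇒∈subformulas ψ⊑a))
⊑⇒∈subformulas (⊑-∧ʳ {a = a} ψ⊑b) =
  there (∈-++⁺ʳ (subformulas a) (⊑⇒∈subformulas ψ⊑b))
⊑⇒∈subformulas (⊑-∨ˡ ψ⊑a) = there (∈-++⁺ˡ (⊑⇒∈subformulas ψ⊑a))
⊑⇒∈subformulas (⊑-∨ʳ {a = a} ψ⊑b) =
  there (∈-++⁺ʳ (subformulas a) (⊑⇒∈subformulas ψ⊑b))
⊑⇒∈subformulas (⊑-≥ ψ⊑a) = there (⊑⇒∈subformulas ψ⊑a)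
⊑⇒∈subformulas (⊑-≤ ψ⊑a) = there (⊑⇒∈subformulas ψ⊑a)

md-⊑ : ∀ {ψ χ} → ψ ⊑ χ → md ψ ≤ md χ
md-⊑ ⊑-refl = ≤-refl
md-⊑ (⊑-∧ˡ ψ⊑a) = ≤-trans (md-⊑ ψ⊑a) (m≤m⊔n _ _)
md-⊑ (⊑-∧ʳ ψ⊑b) = ≤-trans (md-⊑ ψ⊑b) (m≤n⊔m _ _)
md-⊑ (⊑-∨ˡ ψ⊑a) = ≤-trans (md-⊑ ψ⊑a) (m≤m⊔n _ _)
md-⊑ (⊑-∨ʳ ψ⊑b) = ≤-trans (md-⊑ ψ⊑b) (m≤n⊔m _ _)
md-⊑ (⊑-≥ ψ⊑a) = m≤n⇒m≤1+n (md-⊑ ψ⊑a)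
md-⊑ (⊑-≤ ψ⊑a) = m≤n⇒m≤1+n (md-⊑ ψ⊑a)

data Body : Fml → Fml → Set where
  ≥-body : ∀ {R n a} → Body (⟨ R ⟩≥ n ∙ a) a
  ≤-body : ∀ {R n a} → Body (⟨ R ⟩≤ n ∙ a) a

body-⊑ : ∀ {ψ a} → Body ψ a → a ⊑ ψ
body-⊑ ≥-body = ⊑-≥ ⊑-refl
body-⊑ ≤-body = ⊑-≤ ⊑-refl

md-body : ∀ {ψ a} → Body ψ a → md a < md ψ
md-body ≥-body = ≤-refl
md-body ≤-body = ≤-refl

-- ∼ rewrites the connectives above a modality but leaves its body untouched.
body-⊑-∼ : ∀ {ψ a} χ → Body ψ a → ψ ⊑ ∼ χ → a ⊑ χ
body-⊑-∼ (atom _) () ⊑-refl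
body-⊑-∼ (natom _) () ⊑-refl
body-⊑-∼ (c ∧ d) b (⊑-∨ˡ ψ⊑∼c) = ⊑-∧ˡ (body-⊑-∼ c b ψ⊑∼c)
body-⊑-∼ (c ∧ d) b (⊑-∨ʳ ψ⊑∼d) = ⊑-∧ʳ (body-⊑-∼ d b ψ⊑∼d)
body-⊑-∼ (c ∨ d) b (⊑-∧ˡ ψ⊑∼c) = ⊑-∨ˡ (body-⊑-∼ c b ψ⊑∼c)
body-⊑-∼ (c ∨ d) b (⊑-∧ʳ ψ⊑∼d) = ⊑-∨ʳ (body-⊑-∼ d b ψ⊑∼d)
body-⊑-∼ (⟨ _ ⟩≥ zero ∙ _) () (⊑-∧ˡ ⊑-refl)
body-⊑-∼ (⟨ _ ⟩≥ zero ∙ _) () (⊑-∧ʳ ⊑-refl)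
body-⊑-∼ (⟨ _ ⟩≥ suc _ ∙ c) ≤-body ⊑-refl = ⊑-≥ ⊑-refl
body-⊑-∼ (⟨ _ ⟩≥ suc _ ∙ c) b (⊑-≤ ψ⊑c) = ⊑-≥ (⊑-trans (body-⊑ b) ψ⊑c)
body-⊑-∼ (⟨ _ ⟩≤ _ ∙ c) ≥-body ⊑-refl = ⊑-≤ ⊑-refl
body-⊑-∼ (⟨ _ ⟩≤ _ ∙ c) b (⊑-≥ ψ⊑c) = ⊑-≤ (⊑-trans (body-⊑ b) ψ⊑c)

InClosure : Fml → Fml → Set
InClosure φ ψ = ψ ⊑ φ ⊎ ∃[ χ ] χ ⊑ φ × ψ ⊑ ∼ χ

closure : Fml → List Fml
closure φ = subformulas φ ++ concatMap (subformulas ∘ ∼_) (subformulas φ)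

InClosure⇒∈closure : ∀ {φ ψ} → InClosure φ ψ → ψ ∈ closure φ
InClosure⇒∈closure (inj₁ ψ⊑φ) = ∈-++⁺ˡ (⊑⇒∈subformulas ψ⊑φ)
InClosure⇒∈closure {φ} (inj₂ (χ , χ⊑φ , ψ⊑∼χ)) =
  ∈-++⁺ʳ (subformulas φ)
    (∈-concatMap⁺ (subformulas ∘ ∼_)
      (lose (⊑⇒∈subformulas χ⊑φ) (⊑⇒∈subformulas ψ⊑∼χ)))

InClosure-⊑ : ∀ {φ ψ χ} → ψ ⊑ χ → InClosure φ χ → InClosure φ ψ
InClosure-⊑ ψ⊑χ (inj₁ χ⊑φ) = inj₁ (⊑-trans ψ⊑χ χ⊑φ)
InClosure-⊑ ψ⊑χ (inj₂ (θ , θ⊑φ , χ⊑∼θ)) = inj₂ (θ , θ⊑φ , ⊑-trans ψ⊑χ χ⊑∼θ)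

InClosure-body : ∀ {φ ψ a} → Body ψ a → InClosure φ ψ → InClosure φ a × InClosure φ (∼ a)
InClosure-body {φ} {ψ} {a} b ψ∈cl = inj₁ (a⊑φ ψ∈cl) , inj₂ (a , a⊑φ ψ∈cl , ⊑-refl)
  where
  a⊑φ : InClosure φ ψ → a ⊑ φ
  a⊑φ (inj₁ ψ⊑φ) = ⊑-trans (body-⊑ b) ψ⊑φ
  a⊑φ (inj₂ (χ , χ⊑φ , ψ⊑∼χ)) = ⊑-trans (body-⊑-∼ χ b ψ⊑∼χ) χ⊑φ

md-choose : ∀ c → md (choose c) ≤ md (proj₁ c)
md-choose (_ , true) = ≤-refl
md-choose (a , false) = md-∼ a

InClosure-choose : ∀ {φ} c → InClosure φ (proj₁ c) × InClosure φ (∼ proj₁ c) →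
                   InClosure φ (choose c)
InClosure-choose (_ , true) = proj₁
InClosure-choose (_ , false) = proj₂

_≟ᶠ_ : DecidableEquality Fml
atom p ≟ᶠ atom q = map′ (cong atom) (λ { refl → refl }) (p ℕ.≟ q)
natom p ≟ᶠ natom q = map′ (cong natom) (λ { refl → refl }) (p ℕ.≟ q)
(a ∧ b) ≟ᶠ (c ∧ d) =
  map′ (λ { (refl , refl) → refl }) (λ { refl → refl , refl }) (a ≟ᶠ c ×-dec b ≟ᶠ d)
(a ∨ b) ≟ᶠ (c ∨ d) =
  map′ (λ { (refl , refl) → refl }) (λ { refl → refl , refl }) (a ≟ᶠ c ×-dec b ≟ᶠ d)
(⟨ R ⟩≥ n ∙ a) ≟ᶠ (⟨ R′ ⟩≥ n′ ∙ a′) =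
  map′ (λ { (refl , refl , refl) → refl }) (λ { refl → refl , refl , refl })
       (R ℕ.≟ R′ ×-dec n ℕ.≟ n′ ×-dec a ≟ᶠ a′)
(⟨ R ⟩≤ n ∙ a) ≟ᶠ (⟨ R′ ⟩≤ n′ ∙ a′) =
  map′ (λ { (refl , refl , refl) → refl }) (λ { refl → refl , refl , refl })
       (R ℕ.≟ R′ ×-dec n ℕ.≟ n′ ×-dec a ≟ᶠ a′)
atom _ ≟ᶠ natom _ = no λ ()
atom _ ≟ᶠ (_ ∧ _) = no λ ()
atom _ ≟ᶠ (_ ∨ _) = no λ ()
atom _ ≟ᶠ (⟨ _ ⟩≥ _ ∙ _) = no λ ()
atom _ ≟ᶠ (⟨ _ ⟩≤ _ ∙ _) = no λ ()
natom _ ≟ᶠ atom _ = no λ ()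
natom _ ≟ᶠ (_ ∧ _) = no λ ()
natom _ ≟ᶠ (_ ∨ _) = no λ ()
natom _ ≟ᶠ (⟨ _ ⟩≥ _ ∙ _) = no λ ()
natom _ ≟ᶠ (⟨ _ ⟩≤ _ ∙ _) = no λ ()
(_ ∧ _) ≟ᶠ atom _ = no λ ()
(_ ∧ _) ≟ᶠ natom _ = no λ ()
(_ ∧ _) ≟ᶠ (_ ∨ _) = no λ ()
(_ ∧ _) ≟ᶠ (⟨ _ ⟩≥ _ ∙ _) = no λ ()
(_ ∧ _) ≟ᶠ (⟨ _ ⟩≤ _ ∙ _) = no λ ()
(_ ∨ _) ≟ᶠ atom _ = no λ ()
(_ ∨ _) ≟ᶠ natom _ = no λ ()
(_ ∨ _) ≟ᶠ (_ ∧ _) = no λ ()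
(_ ∨ _) ≟ᶠ (⟨ _ ⟩≥ _ ∙ _) = no λ ()
(_ ∨ _) ≟ᶠ (⟨ _ ⟩≤ _ ∙ _) = no λ ()
(⟨ _ ⟩≥ _ ∙ _) ≟ᶠ atom _ = no λ ()
(⟨ _ ⟩≥ _ ∙ _) ≟ᶠ natom _ = no λ ()
(⟨ _ ⟩≥ _ ∙ _) ≟ᶠ (_ ∧ _) = no λ ()
(⟨ _ ⟩≥ _ ∙ _) ≟ᶠ (_ ∨ _) = no λ ()
(⟨ _ ⟩≥ _ ∙ _) ≟ᶠ (⟨ _ ⟩≤ _ ∙ _) = no λ ()
(⟨ _ ⟩≤ _ ∙ _) ≟ᶠ atom _ = no λ ()
(⟨ _ ⟩≤ _ ∙ _) ≟ᶠ natom _ = no λ ()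
(⟨ _ ⟩≤ _ ∙ _) ≟ᶠ (_ ∧ _) = no λ ()
(⟨ _ ⟩≤ _ ∙ _) ≟ᶠ (_ ∨ _) = no λ ()
(⟨ _ ⟩≤ _ ∙ _) ≟ᶠ (⟨ _ ⟩≥ _ ∙ _) = no λ ()

_≟ᶜ_ : DecidableEquality Constraint
(x ⊨ a) ≟ᶜ (y ⊨ b) =
  map′ (λ { (refl , refl) → refl }) (λ { refl → refl , refl }) (x ℕ.≟ y ×-dec a ≟ᶠ b)
edge R x z ≟ᶜ edge R′ x′ z′ =
  map′ (λ { (refl , refl , refl) → refl }) (λ { refl → refl , refl , refl })
       (R ℕ.≟ R′ ×-dec x ℕ.≟ x′ ×-dec z ℕ.≟ z′)
(_ ⊨ _) ≟ᶜ edge _ _ _ = no λ ()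
edge _ _ _ ≟ᶜ (_ ⊨ _) = no λ ()

open import Data.List.Membership.DecPropositional _≟ᶜ_ using (_∈?_)

occursIn? : ∀ u c → Dec (OccursIn u c)
occursIn? u (x ⊨ _) = u ℕ.≟ x
occursIn? u (edge _ x z) = u ℕ.≟ x ⊎-dec u ℕ.≟ z

Occurs : Var → CS → Set
Occurs u = Any (OccursIn u)

occurs? : ∀ u S → Dec (Occurs u S)
occurs? u = any? (occursIn? u)

∈⇒Occurs : ∀ {u ψ S} → (u ⊨ ψ) ∈ S → Occurs u S
∈⇒Occurs = Any.map λ { refl → refl }

edge∈⇒Occurs : ∀ {R u v S} → edge R u v ∈ S → Occurs v S
edge∈⇒Occurs = Any.map λ { refl → inj₂ refl }

-- Any strict upper bound on the variables of S would do in place of bound S.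
mentioned : Constraint → ℕ
mentioned (x ⊨ _) = x
mentioned (edge _ x z) = x + z

bound : CS → ℕ
bound S = suc (∑ mentioned S)

Occurs⇒<bound : ∀ {u S} → Occurs u S → u < bound S
Occurs⇒<bound {u} o with find o
... | c , c∈S , u∈c = s≤s (≤-trans (≤mentioned c u∈c) (∑-∈-≤ mentioned c∈S))
  where
  ≤mentioned : ∀ c → OccursIn u c → u ≤ mentioned c
  ≤mentioned (_ ⊨ _) refl = ≤-refl
  ≤mentioned (edge _ x z) (inj₁ refl) = m≤m+n x z
  ≤mentioned (edge _ x z) (inj₂ refl) = m≤n+m z x

bound-++ : ∀ T S → bound S ≤ bound (T ++ S)
bound-++ T S = s≤s (subst (∑ mentioned S ≤_) (sym (∑-++ mentioned T S)) (m≤n+m _ _))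

depthIn : Var → Constraint → ℕ
depthIn u (z ⊨ ψ) = when (u ℕ.≟ z) (md ψ)
depthIn u (edge _ _ _) = 0

depth : Var → CS → ℕ
depth u [] = 0
depth u (c ∷ S) = depthIn u c ⊔ depth u S

depth-∈ : ∀ {u ψ S} → (u ⊨ ψ) ∈ S → md ψ ≤ depth u S
depth-∈ {u} (here refl) with u ℕ.≟ u
... | yes _ = m≤m⊔n _ _
... | no u≢u = ⊥-elim (u≢u refl)
depth-∈ (there ψ∈S) = ≤-trans (depth-∈ ψ∈S) (m≤n⊔m _ _)

depth-lub : ∀ {u d} S → (∀ {ψ} → (u ⊨ ψ) ∈ S → md ψ ≤ d) → depth u S ≤ d
depth-lub [] _ = z≤n
depth-lub {u} {d} (c ∷ S) md≤d =
  ⊔-lub (depthIn-lub c (md≤d ∘ here)) (depth-lub S (md≤d ∘ there))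
  where
  depthIn-lub : ∀ c → (∀ {ψ} → (u ⊨ ψ) ≡ c → md ψ ≤ d) → depthIn u c ≤ d
  depthIn-lub (z ⊨ ψ) md≤d with u ℕ.≟ z
  ... | yes refl = md≤d refl
  ... | no _ = z≤n
  depthIn-lub (edge _ _ _) _ = z≤n

depth-lub-< : ∀ {u d} S → 0 < d → (∀ {ψ} → (u ⊨ ψ) ∈ S → md ψ < d) → depth u S < d
depth-lub-< S (s≤s _) md<d = s≤s (depth-lub S (≤-pred ∘ md<d))

depth-++-≤ : ∀ {u} T S → (∀ {ψ} → (u ⊨ ψ) ∈ T → md ψ ≤ depth u S) →
             depth u (T ++ S) ≤ depth u S
depth-++-≤ T S md≤ = depth-lub (T ++ S) λ ∈T++S → [ md≤ , depth-∈ ]′ (∈-++⁻ T ∈T++S)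

Linked : CS → Rel → Var → Fml → Var → Set
Linked S R x ψ y = edge R x y ∈ S × (y ⊨ ψ) ∈ S

linked? : ∀ S R x ψ y → Dec (Linked S R x ψ y)
linked? S R x ψ y = edge R x y ∈? S ×-dec (y ⊨ ψ) ∈? S

-- ♯R^S(x, ψ): every y linked to x occurs in S, so summing below bound S counts them all.
♯ : CS → Rel → Var → Fml → ℕ
♯ S R x ψ = ∑< (bound S) (λ y → 𝟙 (linked? S R x ψ y))

CountBelow⇒♯< : ∀ {S R x ψ n} → CountBelow S R x ψ n → ♯ S R x ψ < n
CountBelow⇒♯< {S} {R} {x} {ψ} below =
  ≰⇒> (below ∘ ∑<-𝟙-witnesses (linked? S R x ψ) (bound S))

module _ {R : Rel} {x : Var} {ψ : Fml} (T S : CS) where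

  linked-++ : ∀ y → 𝟙 (linked? S R x ψ y) ≤ 𝟙 (linked? (T ++ S) R x ψ y)
  linked-++ y = 𝟙-mono (Data.Product.map (∈-++⁺ʳ T) (∈-++⁺ʳ T)) _ _

  ♯-++-≤ : ♯ S R x ψ ≤ ♯ (T ++ S) R x ψ
  ♯-++-≤ = ≤-trans (∑-mono-≤ (downFrom (bound S)) linked-++) (∑<-grow _ (bound-++ T S))

  ♯-++-< : ∀ {y} → edge R x y ∉ S → Linked (T ++ S) R x ψ y →
           ♯ S R x ψ < ♯ (T ++ S) R x ψ
  ♯-++-< {y} new linked = begin-strict
    ♯ S R x ψ                                          ≡⟨ ∑<-extend _ (bound-++ T S) unlinked ⟨
    ∑< (bound (T ++ S)) (λ v → 𝟙 (linked? S R x ψ v))  <⟨ ∑-mono-< y∈ linked-++ new-link ⟩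
    ♯ (T ++ S) R x ψ                                   ∎
    where
    open ≤-Reasoning
    y∈ : y ∈ downFrom (bound (T ++ S))
    y∈ = ∈-downFrom⁺ (Occurs⇒<bound (edge∈⇒Occurs (proj₁ linked)))
    new-link : 𝟙 (linked? S R x ψ y) < 𝟙 (linked? (T ++ S) R x ψ y)
    new-link = 𝟙-< (new ∘ proj₁) linked _ _
    unlinked : ∀ v → bound S ≤ v → 𝟙 (linked? S R x ψ v) ≡ 0
    unlinked v B≤v with linked? S R x ψ v
    ... | yes (e , _) = ⊥-elim (<⇒≱ (Occurs⇒<bound (edge∈⇒Occurs e)) B≤v)
    ... | no _ = refl

InModalSet⇒Body : ∀ {S R x a} → InModalSet S R x a → ∃[ ψ ] Body ψ a × (x ⊨ ψ) ∈ S
InModalSet⇒Body (_ , inj₁ ∈S) = _ , ≥-body , ∈S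
InModalSet⇒Body (_ , inj₂ ∈S) = _ , ≤-body , ∈S

InModalSet⇒md< : ∀ {S R x a} → InModalSet S R x a → md a < depth x S
InModalSet⇒md< inModal with InModalSet⇒Body inModal
... | _ , body , ∈S = <-≤-trans (md-body body) (depth-∈ ∈S)

spawn : Rel → Var → Var → List Fml → CS
spawn R x y χs = edge R x y ∷ map (y ⊨_) χs

module _ (R : Rel) (x y : Var) (χs : List Fml) where

  spawn-labels : ∀ {u θ} → (u ⊨ θ) ∈ spawn R x y χs → u ≡ y × θ ∈ χs
  spawn-labels (here ())
  spawn-labels (there ∈labels) with ∈-map⁻ (y ⊨_) ∈labels
  ... | _ , θ∈χs , refl = refl , θ∈χs

  spawn-occurs : ∀ {u} → Occurs u (spawn R x y χs) → u ≡ x ⊎ u ≡ y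
  spawn-occurs (here u∈edge) = u∈edge
  spawn-occurs (there o) = inj₂ (proj₂ (satisfied (Any.map⁻ o)))

  depth-spawn-≤ : ∀ {u} S → u ≢ y → depth u (spawn R x y χs ++ S) ≤ depth u S
  depth-spawn-≤ S u≢y =
    depth-++-≤ (spawn R x y χs) S (⊥-elim ∘ u≢y ∘ proj₁ ∘ spawn-labels)

  depth-spawn-< : ∀ {d} S → ¬ Occurs y S → 0 < d → All (λ χ → md χ < d) χs →
                  depth y (spawn R x y χs ++ S) < d
  depth-spawn-< S y∉S 0<d χs<d = depth-lub-< (spawn R x y χs ++ S) 0<d λ ∈S′ →
    [ (λ ∈spawn → All.lookup χs<d (proj₂ (spawn-labels ∈spawn)))
    , (λ ∈S → ⊥-elim (y∉S (∈⇒Occurs ∈S)))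
    ]′ (∈-++⁻ (spawn R x y χs) ∈S′)

module Measure (φ : Fml) where

  CL : List Fml
  CL = closure φ

  Demand : Set
  Demand = Rel × ℕ × Fml

  demand : Fml → List Demand
  demand (⟨ R ⟩≥ n ∙ a) = (R , n , a) ∷ []
  demand _ = []

  demands : List Demand
  demands = concatMap demand CL

  ∈demands : ∀ {R n a} → (⟨ R ⟩≥ n ∙ a) ∈ CL → (R , n , a) ∈ demands
  ∈demands ψ∈CL = ∈-concatMap⁺ demand (lose ψ∈CL (here refl))

  threshold : Demand → ℕ
  threshold (_ , n , _) = n

  unasserted : CS → Var → Fml → ℕ
  unasserted S u ψ = 𝟙 (¬? ((u ⊨ ψ) ∈? S))

  missing : Var → CS → ℕ
  missing u S = ∑ (unasserted S u) CL

  shortfall : CS → Var → Demand → ℕ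
  shortfall S u (R , n , a) = n ∸ ♯ S R u a

  deficit : Var → CS → ℕ
  deficit u S = ∑ (shortfall S u) demands

  -- weight (suc d) exceeds the core of every variable of depth d (core-<-weight),
  -- so one unit of deficit at a variable of depth d + 1 outweighs a whole new successor.
  weight : ℕ → ℕ
  weight zero = 0
  weight (suc d) = suc (length CL + ∑ threshold demands * weight d)

  core : Var → CS → ℕ
  core u S = missing u S + deficit u S * weight (depth u S)

  potential : Var → CS → ℕ
  potential u S = when (occurs? u S) (core u S)

  μ : CS → ℕ
  μ S = ∑< (bound S) (λ u → potential u S)

  weight-mono : ∀ {d d′} → d ≤ d′ → weight d ≤ weight d′
  weight-mono {zero} _ = z≤n
  weight-mono {suc d} {suc d′} (s≤s d≤d′) =
    s≤s (+-monoʳ-≤ (length CL) (*-monoʳ-≤ (∑ threshold demands) (weight-mono d≤d′)))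

  core-<-weight : ∀ u S → core u S < weight (suc (depth u S))
  core-<-weight u S = s≤s (+-mono-≤ missing-≤ (*-monoˡ-≤ (weight (depth u S)) deficit-≤))
    where
    missing-≤ : missing u S ≤ length CL
    missing-≤ = ∑-≤-length CL (λ _ → 𝟙≤1 _)
    deficit-≤ : deficit u S ≤ ∑ threshold demands
    deficit-≤ = ∑-mono-≤ demands λ { (R , n , a) → m∸n≤m n (♯ S R u a) }

  potential-≤-core : ∀ u S → potential u S ≤ core u S
  potential-≤-core u S with occurs? u S
  ... | yes _ = ≤-refl
  ... | no _ = z≤n

  potential-occurring : ∀ {u S} → Occurs u S → potential u S ≡ core u S
  potential-occurring {u} {S} o with occurs? u S
  ... | yes _ = refl
  ... | no ¬o = ⊥-elim (¬o o)

  potential-unoccurring : ∀ {u S} → ¬ Occurs u S → potential u S ≡ 0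
  potential-unoccurring {u} {S} ¬o with occurs? u S
  ... | yes o = ⊥-elim (¬o o)
  ... | no _ = refl

  μ-++ : ∀ T S → μ S ≡ ∑< (bound (T ++ S)) (λ u → potential u S)
  μ-++ T S = sym (∑<-extend _ (bound-++ T S) λ u B≤u →
    potential-unoccurring {S = S} λ o → <⇒≱ (Occurs⇒<bound o) B≤u)

  module _ {u : Var} (T S : CS) where

    unasserted-++ : ∀ ψ → unasserted (T ++ S) u ψ ≤ unasserted S u ψ
    unasserted-++ ψ = 𝟙-mono (λ ∉T++S → ∉T++S ∘ ∈-++⁺ʳ T) _ _

    shortfall-++ : ∀ d → shortfall (T ++ S) u d ≤ shortfall S u d
    shortfall-++ (R , n , a) = ∸-monoʳ-≤ n (♯-++-≤ T S)

    missing-++-≤ : missing u (T ++ S) ≤ missing u S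
    missing-++-≤ = ∑-mono-≤ CL unasserted-++

    missing-++-< : ∀ {ψ} → ψ ∈ CL → (u ⊨ ψ) ∉ S → (u ⊨ ψ) ∈ T →
                   missing u (T ++ S) < missing u S
    missing-++-< ψ∈CL ∉S ∈T =
      ∑-mono-< ψ∈CL unasserted-++ (𝟙-< (λ ∉T++S → ∉T++S (∈-++⁺ˡ ∈T)) ∉S _ _)

    deficit-++-≤ : deficit u (T ++ S) ≤ deficit u S
    deficit-++-≤ = ∑-mono-≤ demands shortfall-++

    deficit-++-< : ∀ {R n a} → (⟨ R ⟩≥ n ∙ a) ∈ CL → ♯ S R u a < n →
                   ♯ S R u a < ♯ (T ++ S) R u a → deficit u (T ++ S) < deficit u S
    deficit-++-< {n = n} ψ∈CL ♯<n ♯<♯′ = ∑-mono-< (∈demands ψ∈CL) shortfall-++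
      (≤-<-trans (∸-monoʳ-≤ n ♯<♯′) (∸-monoʳ-< (n<1+n _) ♯<n))

    core-++-≤ : depth u (T ++ S) ≤ depth u S → core u (T ++ S) ≤ core u S
    core-++-≤ shallow = +-mono-≤ missing-++-≤ (*-mono-≤ deficit-++-≤ (weight-mono shallow))

    core-++-drop : depth u (T ++ S) ≤ depth u S → deficit u (T ++ S) < deficit u S →
                   core u (T ++ S) + weight (depth u S) ≤ core u S
    core-++-drop shallow less = begin
      missing u (T ++ S) + d′ * weight (depth u (T ++ S)) + w
        ≤⟨ +-monoˡ-≤ w (+-mono-≤ missing-++-≤ (*-monoʳ-≤ d′ (weight-mono shallow))) ⟩
      missing u S + d′ * w + w
        ≡⟨ trans (+-assoc (missing u S) (d′ * w) w) (cong (missing u S +_) (+-comm (d′ * w) w)) ⟩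
      missing u S + suc d′ * w
        ≤⟨ +-monoʳ-≤ (missing u S) (*-monoˡ-≤ w less) ⟩
      core u S ∎
      where
      open ≤-Reasoning
      d′ : ℕ
      d′ = deficit u (T ++ S)
      w : ℕ
      w = weight (depth u S)

    potential-++-≤ : depth u (T ++ S) ≤ depth u S → (Occurs u T → Occurs u S) →
                     potential u (T ++ S) ≤ potential u S
    potential-++-≤ shallow old with occurs? u (T ++ S) | occurs? u S
    ... | no _ | _ = z≤n
    ... | yes _ | yes _ = core-++-≤ shallow
    ... | yes o | no ¬o = ⊥-elim (¬o ([ old , (λ o′ → o′) ]′ (Any.++⁻ T o)))

    potential-++-< : ∀ {ψ} → Occurs u S → ψ ∈ CL → (u ⊨ ψ) ∉ S → (u ⊨ ψ) ∈ T →
                     depth u (T ++ S) ≤ depth u S → potential u (T ++ S) < potential u S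
    potential-++-< o ψ∈CL ∉S ∈T shallow =
      subst₂ _<_ (sym (potential-occurring (Any.++⁺ʳ T o))) (sym (potential-occurring o))
        (+-mono-<-≤ (missing-++-< ψ∈CL ∉S ∈T) (*-mono-≤ deficit-++-≤ (weight-mono shallow)))

  Closed : CS → Set
  Closed S = ∀ {z ψ} → (z ⊨ ψ) ∈ S → InClosure φ ψ

  μ-saturate-< : ∀ {S x ψ χ} χs → Closed S → (x ⊨ ψ) ∈ S → All (_⊑ ψ) χs →
                 χ ∈ χs → (x ⊨ χ) ∉ S → μ (map (x ⊨_) χs ++ S) < μ S
  μ-saturate-< {S} {x} {ψ} {χ} χs closed ψ∈S χs⊑ψ χ∈χs new = begin-strict
    μ (T ++ S)                                  <⟨ ∑-mono-< x∈range no-increase decrease ⟩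
    ∑< (bound (T ++ S)) (λ u → potential u S)   ≡⟨ μ-++ T S ⟨
    μ S                                         ∎
    where
    open ≤-Reasoning
    T : CS
    T = map (x ⊨_) χs
    x∈S : Occurs x S
    x∈S = ∈⇒Occurs ψ∈S
    shallow : ∀ {u θ} → (u ⊨ θ) ∈ T → md θ ≤ depth u S
    shallow ∈T with ∈-map⁻ (x ⊨_) ∈T
    ... | _ , θ∈χs , refl = ≤-trans (md-⊑ (All.lookup χs⊑ψ θ∈χs)) (depth-∈ ψ∈S)
    only-x : ∀ {u} → Occurs u T → Occurs u S
    only-x o with satisfied (Any.map⁻ o)
    ... | _ , refl = x∈S
    no-increase : ∀ u → potential u (T ++ S) ≤ potential u S
    no-increase u = potential-++-≤ T S (depth-++-≤ T S shallow) only-x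
    decrease : potential x (T ++ S) < potential x S
    decrease = potential-++-< T S x∈S
      (InClosure⇒∈closure (InClosure-⊑ (All.lookup χs⊑ψ χ∈χs) (closed ψ∈S)))
      new (∈-map⁺ (x ⊨_) χ∈χs) (depth-++-≤ T S shallow)
    x∈range : x ∈ downFrom (bound (T ++ S))
    x∈range = ∈-downFrom⁺ (Occurs⇒<bound (Any.++⁺ʳ T x∈S))

  module _ {S x y R n ψ} (χs : List Fml) (closed : Closed S)
           (ψ∈S : (x ⊨ (⟨ R ⟩≥ n ∙ ψ)) ∈ S) (♯<n : ♯ S R x ψ < n) (y∉S : ¬ Occurs y S)
           (χs<D : All (λ χ → md χ < depth x S) χs)
           where

    private
      T : CS
      T = spawn R x y (ψ ∷ χs)

      S′ : CS
      S′ = T ++ S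

      x∈S : Occurs x S
      x∈S = ∈⇒Occurs ψ∈S

      x≢y : x ≢ y
      x≢y refl = y∉S x∈S

      no-deeper : ∀ {u} → u ≢ y → depth u S′ ≤ depth u S
      no-deeper = depth-spawn-≤ R x y (ψ ∷ χs) S

      y-shallower : depth y S′ < depth x S
      y-shallower = depth-spawn-< R x y (ψ ∷ χs) S y∉S (≤-<-trans z≤n ψ<D) (ψ<D ∷ χs<D)
        where
        ψ<D : md ψ < depth x S
        ψ<D = depth-∈ ψ∈S

    potential-spawn : potential x S′ + suc (potential y S′) ≤ potential x S
    potential-spawn = begin
      potential x S′ + suc (potential y S′)  ≡⟨ cong (_+ suc (potential y S′)) x-core ⟩
      core x S′ + suc (potential y S′)       ≤⟨ +-monoʳ-≤ (core x S′) y<weight ⟩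
      core x S′ + weight (depth x S)         ≤⟨ core-++-drop T S (no-deeper x≢y) less ⟩
      core x S                               ≡⟨ potential-occurring x∈S ⟨
      potential x S                          ∎
      where
      open ≤-Reasoning
      x-core : potential x S′ ≡ core x S′
      x-core = potential-occurring (Any.++⁺ʳ T x∈S)
      y<weight : potential y S′ < weight (depth x S)
      y<weight = begin-strict
        potential y S′                ≤⟨ potential-≤-core y S′ ⟩
        core y S′                     <⟨ core-<-weight y S′ ⟩
        weight (suc (depth y S′))     ≤⟨ weight-mono y-shallower ⟩
        weight (depth x S)            ∎
      less : deficit x S′ < deficit x S
      less = deficit-++-< T S (InClosure⇒∈closure (closed ψ∈S)) ♯<n
        (♯-++-< T S (y∉S ∘ edge∈⇒Occurs) (here refl , there (here refl)))

    μ-spawn-< : μ (spawn R x y (ψ ∷ χs) ++ S) < μ S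
    μ-spawn-< = begin-strict
      μ S′                                  <⟨ ∑<-transfer _ _ x<B y<B pointwise ⟩
      ∑< (bound S′) (λ u → potential u S)   ≡⟨ μ-++ T S ⟨
      μ S                                   ∎
      where
      open ≤-Reasoning
      x<B : x < bound S′
      x<B = Occurs⇒<bound (Any.++⁺ʳ T x∈S)
      y<B : y < bound S′
      y<B = Occurs⇒<bound {S = S′} (here (inj₂ refl))
      k : ℕ
      k = potential y S′
      pointwise : ∀ u → potential u S′ + when (x ℕ.≟ u) (suc k) ≤ potential u S + when (y ℕ.≟ u) k
      pointwise u with x ℕ.≟ u | y ℕ.≟ u
      ... | yes refl | yes refl = ⊥-elim (x≢y refl)
      ... | yes refl | no _ = subst (potential x S′ + suc k ≤_) (sym (+-identityʳ _)) potential-spawn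
      ... | no _ | yes refl =
        ≤-reflexive (trans (+-identityʳ k) (cong (_+ k) (sym (potential-unoccurring y∉S))))
      ... | no x≢u | no y≢u = +-monoˡ-≤ 0 (potential-++-≤ T S (no-deeper (y≢u ∘ sym)) old)
        where
        old : Occurs u T → Occurs u S
        old o = ⊥-elim ([ x≢u ∘ sym , y≢u ∘ sym ]′ (spawn-occurs R x y (ψ ∷ χs) o))

  ⟶-Closed : ∀ {S S′} → Closed S → S ⟶ S′ → Closed S′
  ⟶-Closed closed (∧-rule (∈S , _)) (here refl) = InClosure-⊑ (⊑-∧ˡ ⊑-refl) (closed ∈S)
  ⟶-Closed closed (∧-rule (∈S , _)) (there (here refl)) =
    InClosure-⊑ (⊑-∧ʳ ⊑-refl) (closed ∈S)
  ⟶-Closed closed (∧-rule _) (there (there ∈S)) = closed ∈S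
  ⟶-Closed closed (∨-rule₁ (∈S , _)) (here refl) = InClosure-⊑ (⊑-∨ˡ ⊑-refl) (closed ∈S)
  ⟶-Closed closed (∨-rule₁ _) (there ∈S) = closed ∈S
  ⟶-Closed closed (∨-rule₂ (∈S , _)) (here refl) = InClosure-⊑ (⊑-∨ʳ ⊑-refl) (closed ∈S)
  ⟶-Closed closed (∨-rule₂ _) (there ∈S) = closed ∈S
  ⟶-Closed closed (≥-rule _ _ _ _ _ _ _ _ _) (here ())
  ⟶-Closed closed (≥-rule _ ∈S _ _ _ _ _ _ _) (there (here refl)) =
    proj₁ (InClosure-body ≥-body (closed ∈S))
  ⟶-Closed closed (≥-rule {y = y} cs _ _ _ _ _ _ _ modal) (there (there ∈S′))
    with ∈-++⁻ (map (λ c → y ⊨ choose c) cs) ∈S′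
  ... | inj₂ ∈S = closed ∈S
  ... | inj₁ ∈choices with ∈-map⁻ (λ c → y ⊨ choose c) ∈choices
  ... | c , c∈cs , refl with InModalSet⇒Body (All.lookup modal (∈-map⁺ proj₁ c∈cs))
  ... | _ , body , ∈S = InClosure-choose c (InClosure-body body (closed ∈S))

  ⟶-μ-< : ∀ {S S′} → Closed S → S ⟶ S′ → μ S′ < μ S
  ⟶-μ-< {S} closed (∧-rule {x = x} {ψ₁} {ψ₂} (∈S , ¬both)) with (x ⊨ ψ₁) ∈? S
  ... | yes ψ₁∈S =
    μ-saturate-< (ψ₁ ∷ ψ₂ ∷ []) closed ∈S (⊑-∧ˡ ⊑-refl ∷ ⊑-∧ʳ ⊑-refl ∷ [])
      (there (here refl)) (λ ψ₂∈S → ¬both (ψ₁∈S , ψ₂∈S))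
  ... | no ψ₁∉S =
    μ-saturate-< (ψ₁ ∷ ψ₂ ∷ []) closed ∈S (⊑-∧ˡ ⊑-refl ∷ ⊑-∧ʳ ⊑-refl ∷ []) (here refl) ψ₁∉S
  ⟶-μ-< closed (∨-rule₁ (∈S , ψ₁∉S , _)) =
    μ-saturate-< (_ ∷ []) closed ∈S (⊑-∨ˡ ⊑-refl ∷ []) (here refl) ψ₁∉S
  ⟶-μ-< closed (∨-rule₂ (∈S , _ , ψ₂∉S)) =
    μ-saturate-< (_ ∷ []) closed ∈S (⊑-∨ʳ ⊑-refl ∷ []) (here refl) ψ₂∉S
  ⟶-μ-< {S} closed (≥-rule {x = x} {R} {n} {ψ} {y} cs ∈S below _ _ fresh _ _ modal) =
    subst (λ labels → μ (edge R x y ∷ (y ⊨ ψ) ∷ (labels ++ S)) < μ S) (sym (map-∘ cs))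
      (μ-spawn-< (map choose cs) closed ∈S (CountBelow⇒♯< below) (All.All¬⇒¬Any fresh)
        (All.map⁺ (All.map (λ {c} → ≤-<-trans (md-choose c) ∘ InModalSet⇒md<)
                           (All.map⁻ modal))))

corollary1 : ∀ (φ : Fml) (x₀ : Var) → ¬ InfiniteRun ((x₀ ⊨ φ) ∷ [])
corollary1 φ x₀ (run , run₀ , step) =
  no-infinite-descent (μ ∘ run) λ i → ⟶-μ-< (closed i) (step i)
  where
  open Measure φ
  closed : ∀ i → Closed (run i)
  closed zero = subst Closed (sym run₀) λ { (here refl) → inj₁ ⊑-refl }
  closed (suc i) = ⟶-Closed (closed i) (step i)
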